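{- Let $n,k,a$ be positive integers with $n\geq a\geq 4$ and $a$ even. Let $\mathbf{d}=(n,\ldots,n)\in\mathbb{Z}_+^{2k}$ (all $2k$ entries equal to $n$) and $\mathbf{t}=(ak+1,ak-1,2,\ldots,2)\in\mathbb{Z}_+^{k(n-a)+2}$ (entries $ak+1$, $ak-1$, followed by $k(n-a)$ entries equal to $2$). Then the pair $(\mathbf{d};\mathbf{t})$ is realizable, i.e., it is the degree sequence of a geographic plan.
   Context: Graphs are finite and undirected, with loops and multiple edges allowed; a loop contributes $2$ to the degree of its vertex. A map is an embedding of a connected graph $G=(V,E)$ in a compact surface without boundary such that edges meet only at common endpoints and every connected component of the complement of the image (a country) is homeomorphic to an open disk. The dual graph $G^*$ has the countries as vertices and the same edge set $E$: each edge joins the one or two countries on whose boundary it lies. A plan is a pair $(G,H)$ of graphs with a common edge set; it is geographic if there is a map of $G$ such that $H$ is its dual graph $G^*$ (with the given identification of edges). If $G$ has degree sequence $\mathbf{d}$ and $H$ has degree sequence $\mathbf{t}$ (up to ordering), then $(\mathbf{d};\mathbf{t})$ is the degree sequence of the plan. A pair $(\mathbf{d};\mathbf{t})$ is realizable if it is the degree sequence of some geographic plan. -}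

module Defs where

open import Data.Nat using (ℕ; _*_; _≟_)
open import Data.Fin using (Fin)
open import Data.List using (allFin)
open import Data.Fin.Properties using () renaming (_≟_ to _≟ᶠ_)
open import Data.List using (List; []; _∷_; length; filter; lookup)
open import Data.List.Membership.Propositional using (_∈_)
open import Data.Product using (Σ; _×_)
open import Data.Empty using (⊥)
open import Relation.Nullary using (¬_)
open import Relation.Binary.PropositionalEquality using (_≡_; _≢_)
open import Function.Bundles using (_⇔_)

-- Combinatorial encoding of a map on a compact surface without boundary
-- (orientable or not) by flags: a finite set of flags with three
-- fixed-point-free involutions α₀ (change vertex), α₁ (change edge),
-- α₂ (change country) such that α₀α₂ = α₂α₀ is a fixed-point-free
-- involution, and the generated group acts transitively (G connected).
record CMap : Set where
  field
    nflags : ℕ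
    α₀ α₁ α₂ : Fin nflags → Fin nflags
    α₀-inv : ∀ x → α₀ (α₀ x) ≡ x
    α₁-inv : ∀ x → α₁ (α₁ x) ≡ x
    α₂-inv : ∀ x → α₂ (α₂ x) ≡ x
    α₀-fpf : ∀ x → α₀ x ≢ x
    α₁-fpf : ∀ x → α₁ x ≢ x
    α₂-fpf : ∀ x → α₂ x ≢ x
    α₀₂-comm : ∀ x → α₀ (α₂ x) ≡ α₂ (α₀ x)
    α₀₂-fpf : ∀ x → α₀ (α₂ x) ≢ x

-- x and y lie in the same orbit of the group generated by the maps in fs
-- (all generators are involutions, so this is an equivalence relation).
data Orbit {N : ℕ} (fs : List (Fin N → Fin N)) : Fin N → Fin N → Set where
  here : ∀ {x} → Orbit fs x x
  step : ∀ {f x y} → f ∈ fs → Orbit fs (f x) y → Orbit fs x y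

module _ (M : CMap) where
  open CMap M

  Connected : Set
  Connected = ∀ x y → Orbit (α₀ ∷ α₁ ∷ α₂ ∷ []) x y

  count : {p : ℕ} → (Fin nflags → Fin p) → Fin p → ℕ
  count lab i = length (filter (λ x → lab x ≟ᶠ i) (allFin nflags))

  -- The cells given by the orbits of ⟨gens⟩ can be labelled by the
  -- positions of the list ds (a bijection orbits ↔ positions) so that the
  -- cell labelled i has degree lookup ds i, i.e. its orbit has 2·(ds i) flags.
  CellDegrees : List (Fin nflags → Fin nflags) → List ℕ → Set
  CellDegrees gens ds =
    Σ (Fin nflags → Fin (length ds)) λ lab →
      (∀ x y → (lab x ≡ lab y) ⇔ Orbit gens x y) ×
      (∀ i → count lab i ≡ 2 * lookup ds i)

  VertexDegrees : List ℕ → Set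
  VertexDegrees = CellDegrees (α₁ ∷ α₂ ∷ [])

  CountryDegrees : List ℕ → Set
  CountryDegrees = CellDegrees (α₀ ∷ α₁ ∷ [])

Realizable : List ℕ → List ℕ → Set
Realizable d t = Σ CMap λ M → Connected M × VertexDegrees M d × CountryDegrees M t

-- The map has 2k vertices u₀, w₀, u₁, w₁, …, w₍ₖ₋₁₎ around a cycle: wᵢ is joined to uᵢ by
-- a bundle of m + 1 parallel edges enclosing m = n − a digons, and to uᵢ₊₁ (indices mod k)
-- by a single edge, and every vertex carries h = a/2 − 1 twisted loops (crosscaps), so that
-- every degree is 1 + 2h + (m + 1) = n. Without the loops the cycle of bundles bounds two
-- large countries of degree 2k, and a twisted loop whose ends are adjacent adds two sides to
-- the country it lies in: the loops at the wᵢ lie in the first large country, those at the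
-- uᵢ in the second. Only at u₀ do the ends of loop 0 flank the cycle edge, so that loop has
-- one side in each large country. This moves one side from the second large country to the
-- first, and their degrees become 2k + 2hk ± 1 = ak ± 1, besides the km digons.
module Submission where

open import Defs
open import Data.Bool using (Bool; true; false; not)
open import Data.Bool.Properties using (not-involutive; not-¬)
open import Data.Empty using (⊥-elim)
open import Data.Fin using (Fin; zero; suc; fromℕ; inject₁; cast)
open import Data.Fin.Induction using (<-weakInduction; >-weakInduction)
open import Data.Fin.Properties
  using (_≟_; injective⇒≤; suc-injective; cast-involutive; 2↔Bool; +↔⊎; *↔×)
open import Data.Fin.Relation.Unary.Top
  using (view; ‵fromℕ; ‵inject₁; view-fromℕ; view-inject₁)
open import Data.List using (List; []; _∷_; length; filter; lookup; allFin; map; replicate)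
open import Data.List.Properties using (length-replicate; lookup-replicate)
open import Data.List.Membership.Propositional using (_∈_)
open import Data.List.Membership.Propositional.Properties
  using (∈-filter⁺; ∈-filter⁻; ∈-allFin; ∈-lookup; ∈-map⁺; ∈-map⁻)
open import Data.List.Relation.Binary.Subset.Propositional using (_⊆_)
open import Data.List.Relation.Unary.All using (All; _∷_)
open import Data.List.Relation.Unary.AllPairs using (_∷_)
open import Data.List.Relation.Unary.Any using (here; there) renaming (index to position)
open import Data.List.Relation.Unary.Any.Properties using (lookup-index)
open import Data.List.Relation.Unary.Unique.Propositional using (Unique)
import Data.List.Relation.Unary.Unique.Propositional.Properties as Unique
open import Data.Nat using (ℕ; zero; suc; _+_; _*_; _∸_; _≤_; s≤s; z≤n)
open import Data.Nat.Divisibility using (_∣_; divides)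
open import Data.Nat.Properties using (≤-antisym; *-comm; m+[n∸m]≡n)
open import Data.Nat.Tactic.RingSolver using (solve-∀)
open import Data.Product using (∃-syntax; _×_; _,_; proj₁; proj₂)
open import Data.Product.Function.NonDependent.Propositional using (_×-↔_)
open import Data.Sum using (_⊎_; inj₁; inj₂)
open import Data.Sum.Function.Propositional using (_⊎-↔_)
open import Function using (_∘_)
open import Function.Bundles using (_↔_; Inverse; mk⇔)
open import Function.Properties.Inverse using (↔-refl; ↔-sym; ↔-trans)
open import Relation.Binary.Construct.Closure.ReflexiveTransitive as Star
  using (Star; ε; _◅_; _◅◅_)
open import Relation.Binary.PropositionalEquality

module _ {A : Set} where

  Step : List (A → A) → A → A → Set
  Step fs x y = ∃[ f ] f ∈ fs × f x ≡ y

  Reach : List (A → A) → A → A → Set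
  Reach fs = Star (Step fs)

  Involutive : List (A → A) → Set
  Involutive fs = ∀ {f} → f ∈ fs → ∀ x → f (f x) ≡ x

  infixl 6 _▷_ _▷⟨_⟩_

  _▷⟨_⟩_ : ∀ {fs f x y z} → Reach fs x y → f ∈ fs → f y ≡ z → Reach fs x z
  p ▷⟨ f∈fs ⟩ eq = p ◅◅ (_ , f∈fs , eq) ◅ ε

  _▷_ : ∀ {fs f x y} → Reach fs x y → f ∈ fs → Reach fs x (f y)
  p ▷ f∈fs = p ▷⟨ f∈fs ⟩ refl

  reach-sym : ∀ {fs} → Involutive fs → ∀ {x y} → Reach fs x y → Reach fs y x
  reach-sym inv = Star.reverse λ { (f , f∈fs , refl) → f , f∈fs , inv f∈fs _ }

  reach-mono : ∀ {fs gs} → fs ⊆ gs → ∀ {x y} → Reach fs x y → Reach gs x y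
  reach-mono fs⊆gs = Star.map λ { (f , f∈fs , eq) → f , fs⊆gs f∈fs , eq }

record FibreEnumeration {A L : Set} (lab : A → L) (ℓ : L) (n : ℕ) : Set₁ where
  field
    Index : Set
    Index↔Fin : Index ↔ Fin n
    elem : Index → A
    index : A → Index
    lab-elem : ∀ t → lab (elem t) ≡ ℓ
    index-elem : ∀ t → index (elem t) ≡ t
    elem-index : ∀ y → lab y ≡ ℓ → elem (index y) ≡ y

lookup-injective : ∀ {A : Set} {xs : List A} → Unique xs →
  ∀ i j → lookup xs i ≡ lookup xs j → i ≡ j
lookup-injective (_ ∷ _) zero zero _ = refl
lookup-injective (x∉xs ∷ _) zero (suc j) eq = ⊥-elim (lookup-≢ x∉xs j eq)
  where
  lookup-≢ : ∀ {A : Set} {x : A} {xs} → All (x ≢_) xs → ∀ j → x ≢ lookup xs j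
  lookup-≢ (x≢y ∷ _) zero = x≢y
  lookup-≢ (_ ∷ x≢ys) (suc j) = lookup-≢ x≢ys j
lookup-injective u@(_ ∷ _) (suc i) zero eq = sym (lookup-injective u zero (suc i) (sym eq))
lookup-injective (_ ∷ u) (suc i) (suc j) eq = cong suc (lookup-injective u i j eq)

fibre-length : ∀ {N p n} {lab : Fin N → Fin p} {ℓ} → FibreEnumeration lab ℓ n →
  length (filter (λ x → lab x ≟ ℓ) (allFin N)) ≡ n
fibre-length {N} {lab = lab} {ℓ} E =
  ≤-antisym (injective⇒≤ {f = position↦index} position↦index-injective)
            (injective⇒≤ {f = index↦position} index↦position-injective)
  where
  open FibreEnumeration E
  open Inverse Index↔Fin using (to; from; strictlyInverseˡ; strictlyInverseʳ)
  fibre = filter (λ x → lab x ≟ ℓ) (allFin N)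
  g : Fin _ → Fin N
  g = elem ∘ from
  g∈fibre : ∀ j → g j ∈ fibre
  g∈fibre j = ∈-filter⁺ (λ x → lab x ≟ ℓ) (∈-allFin (g j)) (lab-elem (from j))
  g-injective : ∀ {i j} → g i ≡ g j → i ≡ j
  g-injective {i} {j} eq = begin
    i                    ≡⟨ strictlyInverseˡ i ⟨
    to (from i)          ≡⟨ cong to (index-elem (from i)) ⟨
    to (index (g i))     ≡⟨ cong (to ∘ index) eq ⟩
    to (index (g j))     ≡⟨ cong to (index-elem (from j)) ⟩
    to (from j)          ≡⟨ strictlyInverseˡ j ⟩
    j                    ∎
    where open ≡-Reasoning
  index↦position : Fin _ → Fin (length fibre)
  index↦position j = position (g∈fibre j)
  index↦position-injective : ∀ {i j} → index↦position i ≡ index↦position j → i ≡ j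
  index↦position-injective {i} {j} eq = g-injective (begin
    g i                                   ≡⟨ lookup-index (g∈fibre i) ⟩
    lookup fibre (index↦position i)       ≡⟨ cong (lookup fibre) eq ⟩
    lookup fibre (index↦position j)       ≡⟨ lookup-index (g∈fibre j) ⟨
    g j                                   ∎)
    where open ≡-Reasoning
  in-fibre : ∀ l → lab (lookup fibre l) ≡ ℓ
  in-fibre l = proj₂ (∈-filter⁻ (λ x → lab x ≟ ℓ) {xs = allFin N} (∈-lookup {xs = fibre} l))
  position↦index : Fin (length fibre) → Fin _
  position↦index l = to (index (lookup fibre l))
  position↦index-injective : ∀ {l l′} → position↦index l ≡ position↦index l′ → l ≡ l′
  position↦index-injective {l} {l′} eq =
    lookup-injective (Unique.filter⁺ (λ x → lab x ≟ ℓ) (Unique.allFin⁺ N)) l l′ (begin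
      lookup fibre l                       ≡⟨ elem-index _ (in-fibre l) ⟨
      elem (index (lookup fibre l))        ≡⟨ cong elem (strictlyInverseʳ _) ⟨
      g (position↦index l)                 ≡⟨ cong g eq ⟩
      g (position↦index l′)                ≡⟨ cong elem (strictlyInverseʳ _) ⟩
      elem (index (lookup fibre l′))       ≡⟨ elem-index _ (in-fibre l′) ⟩
      lookup fibre l′                      ∎)
    where open ≡-Reasoning

record FlagSystem : Set₁ where
  field
    Flag : Set
    size : ℕ
    enumeration : Flag ↔ Fin size
    α₀ α₁ α₂ : Flag → Flag
    α₀-inv : ∀ x → α₀ (α₀ x) ≡ x
    α₁-inv : ∀ x → α₁ (α₁ x) ≡ x
    α₂-inv : ∀ x → α₂ (α₂ x) ≡ x
    α₀-fpf : ∀ x → α₀ x ≢ x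
    α₁-fpf : ∀ x → α₁ x ≢ x
    α₂-fpf : ∀ x → α₂ x ≢ x
    α₀₂-comm : ∀ x → α₀ (α₂ x) ≡ α₂ (α₀ x)
    α₀₂-fpf : ∀ x → α₀ (α₂ x) ≢ x

record CellDecomposition {Flag : Set} (gens : List (Flag → Flag)) (ds : List ℕ) : Set₁ where
  field
    cell : Flag → Fin (length ds)
    cell-invariant : ∀ {f} → f ∈ gens → ∀ y → cell (f y) ≡ cell y
    centre : Fin (length ds) → Flag
    reach-from-centre : ∀ y → Reach gens (centre (cell y)) y
    cell-size : ∀ ℓ → FibreEnumeration cell ℓ (2 * lookup ds ℓ)

module FlagMap (S : FlagSystem) where
  open FlagSystem S
  open Inverse enumeration using (to; from; strictlyInverseˡ; strictlyInverseʳ)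

  conj : (Flag → Flag) → Fin size → Fin size
  conj f = to ∘ f ∘ from

  private
    conj-∘ : ∀ f g X → conj f (conj g X) ≡ conj (f ∘ g) X
    conj-∘ f g X = cong (to ∘ f) (strictlyInverseʳ (g (from X)))

    conj-inv : ∀ f → (∀ y → f (f y) ≡ y) → ∀ X → conj f (conj f X) ≡ X
    conj-inv f inv X = trans (conj-∘ f f X) (trans (cong to (inv (from X))) (strictlyInverseˡ X))

    conj-fpf : ∀ f → (∀ y → f y ≢ y) → ∀ X → conj f X ≢ X
    conj-fpf f fpf X eq = fpf (from X) (trans (sym (strictlyInverseʳ _)) (cong from eq))

  cmap : CMap
  cmap = record
    { nflags = size
    ; α₀ = conj α₀ ; α₁ = conj α₁ ; α₂ = conj α₂
    ; α₀-inv = conj-inv α₀ α₀-inv ; α₁-inv = conj-inv α₁ α₁-inv ; α₂-inv = conj-inv α₂ α₂-inv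
    ; α₀-fpf = conj-fpf α₀ α₀-fpf ; α₁-fpf = conj-fpf α₁ α₁-fpf ; α₂-fpf = conj-fpf α₂ α₂-fpf
    ; α₀₂-comm = λ X → trans (conj-∘ α₀ α₂ X)
                         (trans (cong to (α₀₂-comm (from X))) (sym (conj-∘ α₂ α₀ X)))
    ; α₀₂-fpf = λ X eq → conj-fpf (α₀ ∘ α₂) α₀₂-fpf X (trans (sym (conj-∘ α₀ α₂ X)) eq)
    }

  reach⇒orbit : ∀ {fs x y} → Reach fs x y → Orbit (map conj fs) (to x) (to y)
  reach⇒orbit ε = here
  reach⇒orbit {x = x} {y} ((f , f∈fs , refl) ◅ p) =
    step (∈-map⁺ conj f∈fs)
         (subst (λ z → Orbit _ (to (f z)) (to y)) (sym (strictlyInverseʳ x)) (reach⇒orbit p))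

  connected : (∀ x y → Reach (α₀ ∷ α₁ ∷ α₂ ∷ []) x y) → Connected cmap
  connected reach X Y =
    subst₂ (Orbit _) (strictlyInverseˡ X) (strictlyInverseˡ Y) (reach⇒orbit (reach (from X) (from Y)))

  cellDegrees : ∀ {gens ds} → Involutive gens → CellDecomposition gens ds →
    CellDegrees cmap (map conj gens) ds
  cellDegrees {gens} {ds} inv D =
    cell ∘ from , (λ X Y → mk⇔ (same-cell⇒orbit X Y) orbit⇒same-cell) , size-of
    where
    open CellDecomposition D
    same-cell⇒orbit : ∀ X Y → cell (from X) ≡ cell (from Y) → Orbit (map conj gens) X Y
    same-cell⇒orbit X Y eq = subst₂ (Orbit _) (strictlyInverseˡ X) (strictlyInverseˡ Y) (reach⇒orbit
      (reach-sym inv (reach-from-centre (from X))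
        ◅◅ subst (λ c → Reach gens (centre c) (from Y)) (sym eq) (reach-from-centre (from Y))))
    orbit⇒same-cell : ∀ {X Y} → Orbit (map conj gens) X Y → cell (from X) ≡ cell (from Y)
    orbit⇒same-cell here = refl
    orbit⇒same-cell {X} (step F∈ p) with ∈-map⁻ conj F∈
    ... | f , f∈gens , refl =
      trans (sym (trans (cong cell (strictlyInverseʳ (f (from X)))) (cell-invariant f∈gens (from X))))
            (orbit⇒same-cell p)
    size-of : ∀ ℓ → count cmap (cell ∘ from) ℓ ≡ 2 * lookup ds ℓ
    size-of ℓ = fibre-length (record
      { Index = Index ; Index↔Fin = Index↔Fin
      ; elem = to ∘ elem ; index = index ∘ from
      ; lab-elem = λ t → trans (cong cell (strictlyInverseʳ (elem t))) (lab-elem t)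
      ; index-elem = λ t → trans (cong index (strictlyInverseʳ (elem t))) (index-elem t)
      ; elem-index = λ X eq → trans (cong to (elem-index (from X) eq)) (strictlyInverseˡ X)
      })
      where open FibreEnumeration (cell-size ℓ)

infixr 4 _⊎-↔Fin_
infixr 5 _×-↔Fin_

_⊎-↔Fin_ : ∀ {A B : Set} {m n} → A ↔ Fin m → B ↔ Fin n → (A ⊎ B) ↔ Fin (m + n)
f ⊎-↔Fin g = ↔-trans (f ⊎-↔ g) (↔-sym +↔⊎)

_×-↔Fin_ : ∀ {A B : Set} {m n} → A ↔ Fin m → B ↔ Fin n → (A × B) ↔ Fin (m * n)
f ×-↔Fin g = ↔-trans (f ×-↔ g) (↔-sym *↔×)

Bool↔Fin2 : Bool ↔ Fin 2
Bool↔Fin2 = ↔-sym 2↔Bool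

resize : ∀ {A : Set} {m n} → A ↔ Fin m → m ≡ n → A ↔ Fin n
resize f refl = f

lookup-replicate′ : ∀ {A : Set} n (x : A) i → lookup (replicate n x) i ≡ x
lookup-replicate′ n x i = begin
  lookup (replicate n x) i
    ≡⟨ cong (lookup (replicate n x))
            (cast-involutive (sym (length-replicate n)) (length-replicate n) i) ⟨
  lookup (replicate n x) (cast (sym (length-replicate n)) (cast (length-replicate n) i))
    ≡⟨ lookup-replicate n x _ ⟩
  x ∎
  where open ≡-Reasoning

-- The flags at one end of a bundle of m + 1 parallel edges which bound m digons:
-- digon j e lies in the j-th digon, top and bot in the two countries outside the bundle.
BundleFlag : ℕ → Set
BundleFlag m = Bool ⊎ (Fin m × Bool)

pattern top = inj₁ false
pattern bot = inj₁ true
pattern digon j e = inj₂ (j , e)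

bundle-α₂ : ∀ {m} → BundleFlag m → BundleFlag m
bundle-α₂ {zero} top = bot
bundle-α₂ {zero} bot = top
bundle-α₂ {suc m} top = digon (fromℕ m) true
bundle-α₂ {suc m} bot = digon zero false
bundle-α₂ {suc m} (digon j true) with view j
... | ‵fromℕ = top
... | ‵inject₁ i = digon (suc i) false
bundle-α₂ {suc m} (digon zero false) = bot
bundle-α₂ {suc m} (digon (suc j) false) = digon (inject₁ j) true

bundle-α₂-involutive : ∀ {m} (b : BundleFlag m) → bundle-α₂ (bundle-α₂ b) ≡ b
bundle-α₂-involutive {zero} top = refl
bundle-α₂-involutive {zero} bot = refl
bundle-α₂-involutive {suc m} top rewrite view-fromℕ m = refl
bundle-α₂-involutive {suc m} bot = refl
bundle-α₂-involutive {suc m} (digon zero false) = refl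
bundle-α₂-involutive {suc m} (digon (suc j) false) rewrite view-inject₁ j = refl
bundle-α₂-involutive {suc m} (digon j true) with view j
... | ‵fromℕ = refl
... | ‵inject₁ i = refl

bundle-side : ∀ {m} → BundleFlag m → Bool
bundle-side top = false
bundle-side bot = true
bundle-side (digon _ e) = e

bundle-side-α₂ : ∀ {m} (b : BundleFlag m) → bundle-side (bundle-α₂ b) ≡ not (bundle-side b)
bundle-side-α₂ {zero} top = refl
bundle-side-α₂ {zero} bot = refl
bundle-side-α₂ {suc m} top = refl
bundle-side-α₂ {suc m} bot = refl
bundle-side-α₂ {suc m} (digon zero false) = refl
bundle-side-α₂ {suc m} (digon (suc j) false) = refl
bundle-side-α₂ {suc m} (digon j true) with view j
... | ‵fromℕ = refl
... | ‵inject₁ i = refl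

bundle-reach : ∀ {A : Set} {gens : List (A → A)} {f₁ f₂} m (emb : BundleFlag m → A) →
  f₁ ∈ gens → f₂ ∈ gens →
  (∀ j e → f₁ (emb (digon j e)) ≡ emb (digon j (not e))) →
  (∀ b → f₂ (emb b) ≡ emb (bundle-α₂ b)) →
  ∀ b → Reach gens (emb bot) (emb b)
bundle-reach zero emb f₁∈ f₂∈ eq₁ eq₂ top = ε ▷⟨ f₂∈ ⟩ eq₂ bot
bundle-reach zero emb f₁∈ f₂∈ eq₁ eq₂ bot = ε
bundle-reach {gens = gens} (suc m) emb f₁∈ f₂∈ eq₁ eq₂ = reach
  where
  reach-digon : ∀ j → Reach gens (emb bot) (emb (digon j false))
  reach-digon = <-weakInduction (λ j → Reach gens (emb bot) (emb (digon j false)))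
    (ε ▷⟨ f₂∈ ⟩ eq₂ bot)
    (λ j p → p ▷⟨ f₁∈ ⟩ eq₁ (inject₁ j) false ▷⟨ f₂∈ ⟩ trans (eq₂ _) (cong emb (next j)))
    where
    next : ∀ j → bundle-α₂ (digon (inject₁ j) true) ≡ digon (suc j) false
    next j rewrite view-inject₁ j = refl
  reach : ∀ b → Reach gens (emb bot) (emb b)
  reach top = reach-digon (fromℕ m) ▷⟨ f₁∈ ⟩ eq₁ (fromℕ m) false
                                   ▷⟨ f₂∈ ⟩ trans (eq₂ _) (cong emb last)
    where
    last : bundle-α₂ (digon (fromℕ m) true) ≡ top
    last rewrite view-fromℕ m = refl
  reach bot = ε
  reach (digon j false) = reach-digon j
  reach (digon j true) = reach-digon j ▷⟨ f₁∈ ⟩ eq₁ j false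

data Kind : Set where
  kind-u₀ kind-u kind-w : Kind

chain-end : ∀ {m} → Kind → BundleFlag m
chain-end kind-w = top
chain-end _ = bot

module Construction (k′ h′ m : ℕ) where

  k h a : ℕ
  k = suc k′
  h = suc h′
  a = suc h * 2

  Local : Set
  Local = Bool ⊎ (Fin h × Bool × Bool) ⊎ BundleFlag m

  pattern link s = inj₁ s
  pattern loop t f s = inj₂ (inj₁ (t , f , s))
  pattern bundle b = inj₂ (inj₂ b)

  -- A flag (i , x , l) lies at wᵢ if x is true and at uᵢ otherwise; at that vertex, link s,
  -- loop t f s and bundle b are the flags on the cycle edge, at end f of the loop t, and on the
  -- bundle, with s the side of the edge.
  Flag : Set
  Flag = Fin k × Bool × Local

  cong-local : ∀ i x {l l′} → l ≡ l′ → _≡_ {A = Flag} (i , x , l) (i , x , l′)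
  cong-local i x = cong (λ l → i , x , l)

  kind : Fin k → Bool → Kind
  kind _ true = kind-w
  kind zero false = kind-u₀
  kind (suc _) false = kind-u

  after-loop : BundleFlag m → Fin h → Local
  after-loop b t with view t
  ... | ‵fromℕ = bundle b
  ... | ‵inject₁ j = loop (suc j) false true

  after-loop-inject₁ : ∀ b j → after-loop b (inject₁ j) ≡ loop (suc j) false true
  after-loop-inject₁ b j rewrite view-inject₁ j = refl

  after-loop-last : ∀ b → after-loop b (fromℕ h′) ≡ bundle b
  after-loop-last b rewrite view-fromℕ h′ = refl

  -- Alternating with α₂, the rotation runs link, loop 0, …, loop (h − 1), bundle; at u₀ the
  -- two ends of loop 0 are instead the first and the last.
  α₁-local : Kind → Local → Local
  α₁-local kind-u (link false) = loop zero false true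
  α₁-local kind-u (link true) = bundle top
  α₁-local kind-u (loop t false false) = loop t true true
  α₁-local kind-u (loop t true true) = loop t false false
  α₁-local kind-u (loop t true false) = after-loop bot t
  α₁-local kind-u (loop zero false true) = link false
  α₁-local kind-u (loop (suc j) false true) = loop (inject₁ j) true false
  α₁-local kind-u (bundle top) = link true
  α₁-local kind-u (bundle bot) = loop (fromℕ h′) true false
  α₁-local kind-u (bundle (digon j e)) = bundle (digon j (not e))
  α₁-local kind-w (link false) = loop zero false true
  α₁-local kind-w (link true) = bundle bot
  α₁-local kind-w (loop t false false) = loop t true true
  α₁-local kind-w (loop t true true) = loop t false false
  α₁-local kind-w (loop t true false) = after-loop top t
  α₁-local kind-w (loop zero false true) = link false
  α₁-local kind-w (loop (suc j) false true) = loop (inject₁ j) true false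
  α₁-local kind-w (bundle top) = loop (fromℕ h′) true false
  α₁-local kind-w (bundle bot) = link true
  α₁-local kind-w (bundle (digon j e)) = bundle (digon j (not e))
  α₁-local kind-u₀ (link false) = loop zero true true
  α₁-local kind-u₀ (link true) = loop zero false false
  α₁-local kind-u₀ (loop t true false) = after-loop bot t
  α₁-local kind-u₀ (loop zero false false) = link true
  α₁-local kind-u₀ (loop zero false true) = bundle top
  α₁-local kind-u₀ (loop zero true true) = link false
  α₁-local kind-u₀ (loop (suc j) false false) = loop (suc j) true true
  α₁-local kind-u₀ (loop (suc j) true true) = loop (suc j) false false
  α₁-local kind-u₀ (loop (suc j) false true) = loop (inject₁ j) true false
  α₁-local kind-u₀ (bundle top) = loop zero false true
  α₁-local kind-u₀ (bundle bot) = loop (fromℕ h′) true false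
  α₁-local kind-u₀ (bundle (digon j e)) = bundle (digon j (not e))

  α₂-local : Local → Local
  α₂-local (link s) = link (not s)
  α₂-local (loop t f s) = loop t f (not s)
  α₂-local (bundle b) = bundle (bundle-α₂ b)

  α₀-link-u : Fin k → Bool → Flag
  α₀-link-u zero s = fromℕ k′ , true , link s
  α₀-link-u (suc j) s = inject₁ j , true , link (not s)

  α₀-link-w : Fin k → Bool → Flag
  α₀-link-w i s with view i
  ... | ‵fromℕ = zero , false , link s
  ... | ‵inject₁ j = suc j , false , link (not s)

  α₀-link-w-inject₁ : ∀ j s → α₀-link-w (inject₁ j) s ≡ (suc j , false , link (not s))
  α₀-link-w-inject₁ j s rewrite view-inject₁ j = refl

  α₀ α₁ α₂ : Flag → Flag
  α₀ (i , x , loop t f s) = i , x , loop t (not f) s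
  α₀ (i , x , bundle b) = i , not x , bundle b
  α₀ (i , false , link s) = α₀-link-u i s
  α₀ (i , true , link s) = α₀-link-w i s
  α₁ (i , x , l) = i , x , α₁-local (kind i x) l
  α₂ (i , x , l) = i , x , α₂-local l

  α₁-local-loop-end : ∀ κ t → α₁-local κ (loop t true false) ≡ after-loop (chain-end κ) t
  α₁-local-loop-end kind-u t = refl
  α₁-local-loop-end kind-w t = refl
  α₁-local-loop-end kind-u₀ t = refl

  α₁-local-after-loop : ∀ κ t → α₁-local κ (after-loop (chain-end κ) t) ≡ loop t true false
  α₁-local-after-loop kind-u t with view t
  ... | ‵fromℕ = refl
  ... | ‵inject₁ j = refl
  α₁-local-after-loop kind-w t with view t
  ... | ‵fromℕ = refl
  ... | ‵inject₁ j = refl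
  α₁-local-after-loop kind-u₀ t with view t
  ... | ‵fromℕ = refl
  ... | ‵inject₁ j = refl

  α₁-local-involutive : ∀ κ l → α₁-local κ (α₁-local κ l) ≡ l
  α₁-local-involutive kind-u (link false) = refl
  α₁-local-involutive kind-u (link true) = refl
  α₁-local-involutive kind-u (loop t false false) = refl
  α₁-local-involutive kind-u (loop t true true) = refl
  α₁-local-involutive kind-u (loop t true false) = α₁-local-after-loop kind-u t
  α₁-local-involutive kind-u (loop zero false true) = refl
  α₁-local-involutive kind-u (loop (suc j) false true) rewrite after-loop-inject₁ bot j = refl
  α₁-local-involutive kind-u (bundle top) = refl
  α₁-local-involutive kind-u (bundle bot) rewrite after-loop-last bot = refl
  α₁-local-involutive kind-u (bundle (digon j e)) rewrite not-involutive e = refl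
  α₁-local-involutive kind-w (link false) = refl
  α₁-local-involutive kind-w (link true) = refl
  α₁-local-involutive kind-w (loop t false false) = refl
  α₁-local-involutive kind-w (loop t true true) = refl
  α₁-local-involutive kind-w (loop t true false) = α₁-local-after-loop kind-w t
  α₁-local-involutive kind-w (loop zero false true) = refl
  α₁-local-involutive kind-w (loop (suc j) false true) rewrite after-loop-inject₁ top j = refl
  α₁-local-involutive kind-w (bundle top) rewrite after-loop-last top = refl
  α₁-local-involutive kind-w (bundle bot) = refl
  α₁-local-involutive kind-w (bundle (digon j e)) rewrite not-involutive e = refl
  α₁-local-involutive kind-u₀ (link false) = refl
  α₁-local-involutive kind-u₀ (link true) = refl
  α₁-local-involutive kind-u₀ (loop zero false false) = refl
  α₁-local-involutive kind-u₀ (loop zero false true) = refl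
  α₁-local-involutive kind-u₀ (loop zero true true) = refl
  α₁-local-involutive kind-u₀ (loop t true false) = α₁-local-after-loop kind-u₀ t
  α₁-local-involutive kind-u₀ (loop (suc j) false false) = refl
  α₁-local-involutive kind-u₀ (loop (suc j) true true) = refl
  α₁-local-involutive kind-u₀ (loop (suc j) false true) rewrite after-loop-inject₁ bot j = refl
  α₁-local-involutive kind-u₀ (bundle top) = refl
  α₁-local-involutive kind-u₀ (bundle bot) rewrite after-loop-last bot = refl
  α₁-local-involutive kind-u₀ (bundle (digon j e)) rewrite not-involutive e = refl

  α₀-involutive : ∀ y → α₀ (α₀ y) ≡ y
  α₀-involutive (zero , false , link s) rewrite view-fromℕ k′ = refl
  α₀-involutive (suc j , false , link s) rewrite view-inject₁ j | not-involutive s = refl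
  α₀-involutive (i , true , link s) with view i
  ... | ‵fromℕ = refl
  ... | ‵inject₁ j rewrite not-involutive s = refl
  α₀-involutive (i , x , loop t f s) rewrite not-involutive f = refl
  α₀-involutive (i , x , bundle b) rewrite not-involutive x = refl

  α₁-involutive : ∀ y → α₁ (α₁ y) ≡ y
  α₁-involutive (i , x , l) = cong-local i x (α₁-local-involutive (kind i x) l)

  α₂-involutive : ∀ y → α₂ (α₂ y) ≡ y
  α₂-involutive (i , x , link s) rewrite not-involutive s = refl
  α₂-involutive (i , x , loop t f s) rewrite not-involutive s = refl
  α₂-involutive (i , x , bundle b) rewrite bundle-α₂-involutive b = refl

  α₀₂-commute : ∀ y → α₀ (α₂ y) ≡ α₂ (α₀ y)
  α₀₂-commute (zero , false , link s) = refl
  α₀₂-commute (suc j , false , link s) = refl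
  α₀₂-commute (i , true , link s) with view i
  ... | ‵fromℕ = refl
  ... | ‵inject₁ j = refl
  α₀₂-commute (i , x , loop t f s) = refl
  α₀₂-commute (i , x , bundle b) = refl

  side : Flag → Bool
  side (i , x , link s) = s
  side (i , x , loop t f s) = s
  side (i , false , bundle b) = bundle-side b
  side (i , true , bundle b) = not (bundle-side b)

  side-after-loop : ∀ i x t → side (i , x , after-loop (chain-end (kind i x)) t) ≡ true
  side-after-loop i true t with view t
  ... | ‵fromℕ = refl
  ... | ‵inject₁ j = refl
  side-after-loop zero false t with view t
  ... | ‵fromℕ = refl
  ... | ‵inject₁ j = refl
  side-after-loop (suc i) false t with view t
  ... | ‵fromℕ = refl
  ... | ‵inject₁ j = refl

  side-α₁ : ∀ y → side (α₁ y) ≡ not (side y)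
  side-α₁ (i , true , link false) = refl
  side-α₁ (i , true , link true) = refl
  side-α₁ (i , true , loop t false false) = refl
  side-α₁ (i , true , loop t true true) = refl
  side-α₁ (i , true , loop t true false) = side-after-loop i true t
  side-α₁ (i , true , loop zero false true) = refl
  side-α₁ (i , true , loop (suc j) false true) = refl
  side-α₁ (i , true , bundle top) = refl
  side-α₁ (i , true , bundle bot) = refl
  side-α₁ (i , true , bundle (digon j e)) = refl
  side-α₁ (suc i , false , link false) = refl
  side-α₁ (suc i , false , link true) = refl
  side-α₁ (suc i , false , loop t false false) = refl
  side-α₁ (suc i , false , loop t true true) = refl
  side-α₁ (suc i , false , loop t true false) = side-after-loop (suc i) false t
  side-α₁ (suc i , false , loop zero false true) = refl
  side-α₁ (suc i , false , loop (suc j) false true) = refl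
  side-α₁ (suc i , false , bundle top) = refl
  side-α₁ (suc i , false , bundle bot) = refl
  side-α₁ (suc i , false , bundle (digon j e)) = refl
  side-α₁ (zero , false , link false) = refl
  side-α₁ (zero , false , link true) = refl
  side-α₁ (zero , false , loop zero false false) = refl
  side-α₁ (zero , false , loop zero false true) = refl
  side-α₁ (zero , false , loop zero true true) = refl
  side-α₁ (zero , false , loop t true false) = side-after-loop zero false t
  side-α₁ (zero , false , loop (suc j) false false) = refl
  side-α₁ (zero , false , loop (suc j) true true) = refl
  side-α₁ (zero , false , loop (suc j) false true) = refl
  side-α₁ (zero , false , bundle top) = refl
  side-α₁ (zero , false , bundle bot) = refl
  side-α₁ (zero , false , bundle (digon j e)) = refl

  side-α₂ : ∀ y → side (α₂ y) ≡ not (side y)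
  side-α₂ (i , x , link s) = refl
  side-α₂ (i , x , loop t f s) = refl
  side-α₂ (i , false , bundle b) = bundle-side-α₂ b
  side-α₂ (i , true , bundle b) = cong not (bundle-side-α₂ b)

  flips-side⇒fpf : (f : Flag → Flag) → (∀ y → side (f y) ≡ not (side y)) → ∀ y → f y ≢ y
  flips-side⇒fpf f flips y eq = not-¬ refl (trans (sym (cong side eq)) (flips y))

  tag : Flag → Bool × Bool
  tag (i , x , loop t f s) = x , f
  tag (i , x , _) = x , false

  tag-α₂ : ∀ y → tag (α₂ y) ≡ tag y
  tag-α₂ (i , x , link s) = refl
  tag-α₂ (i , x , loop t f s) = refl
  tag-α₂ (i , x , bundle b) = refl

  tag-α₀ : ∀ y → tag (α₀ y) ≢ tag y
  tag-α₀ (i , x , loop t f s) eq = not-¬ refl (sym (cong proj₂ eq))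
  tag-α₀ (i , x , bundle b) eq = not-¬ refl (sym (cong proj₁ eq))
  tag-α₀ (zero , false , link s) ()
  tag-α₀ (suc j , false , link s) ()
  tag-α₀ (i , true , link s) eq with view i
  tag-α₀ (i , true , link s) () | ‵fromℕ
  tag-α₀ (i , true , link s) () | ‵inject₁ j

  local↔Fin : Local ↔ Fin (2 + (h * (2 * 2) + (2 + m * 2)))
  local↔Fin = Bool↔Fin2 ⊎-↔Fin (↔-refl ×-↔Fin Bool↔Fin2 ×-↔Fin Bool↔Fin2)
                        ⊎-↔Fin Bool↔Fin2 ⊎-↔Fin (↔-refl ×-↔Fin Bool↔Fin2)

  system : FlagSystem
  system = record
    { Flag = Flag
    ; enumeration = ↔-refl ×-↔Fin Bool↔Fin2 ×-↔Fin local↔Fin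
    ; α₀ = α₀ ; α₁ = α₁ ; α₂ = α₂
    ; α₀-inv = α₀-involutive ; α₁-inv = α₁-involutive ; α₂-inv = α₂-involutive
    ; α₀-fpf = λ y eq → tag-α₀ y (cong tag eq)
    ; α₁-fpf = flips-side⇒fpf α₁ side-α₁
    ; α₂-fpf = flips-side⇒fpf α₂ side-α₂
    ; α₀₂-comm = α₀₂-commute
    ; α₀₂-fpf = λ y eq → tag-α₀ (α₂ y) (trans (cong tag eq) (sym (tag-α₂ y)))
    }

  vertexGens : List (Flag → Flag)
  vertexGens = α₁ ∷ α₂ ∷ []

  v₁ : α₁ ∈ vertexGens
  v₁ = here refl

  v₂ : α₂ ∈ vertexGens
  v₂ = there (here refl)

  vertexGens-involutive : Involutive vertexGens
  vertexGens-involutive (here refl) = α₁-involutive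
  vertexGens-involutive (there (here refl)) = α₂-involutive

  α₁-local-digon : ∀ κ j e → α₁-local κ (bundle (digon j e)) ≡ bundle (digon j (not e))
  α₁-local-digon kind-u j e = refl
  α₁-local-digon kind-w j e = refl
  α₁-local-digon kind-u₀ j e = refl

  α₁-local-loop-false-false : ∀ κ j → α₁-local κ (loop (suc j) false false) ≡ loop (suc j) true true
  α₁-local-loop-false-false kind-u j = refl
  α₁-local-loop-false-false kind-w j = refl
  α₁-local-loop-false-false kind-u₀ j = refl

  reach-first-loop : ∀ i x → Reach vertexGens (i , x , link false) (i , x , loop zero true false)
  reach-first-loop i true = ε ▷ v₁ ▷ v₂ ▷ v₁ ▷ v₂
  reach-first-loop zero false = ε ▷ v₁ ▷ v₂
  reach-first-loop (suc i) false = ε ▷ v₁ ▷ v₂ ▷ v₁ ▷ v₂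

  reach-loop : ∀ i x t → Reach vertexGens (i , x , link false) (i , x , loop t true false)
  reach-loop i x = <-weakInduction _ (reach-first-loop i x) λ j p →
    p ▷⟨ v₁ ⟩ cong-local i x (trans (α₁-local-loop-end (kind i x) (inject₁ j)) (after-loop-inject₁ _ j))
      ▷ v₂ ▷⟨ v₁ ⟩ cong-local i x (α₁-local-loop-false-false (kind i x) j) ▷ v₂

  reach-from-bot : ∀ i x b → Reach vertexGens (i , x , bundle bot) (i , x , bundle b)
  reach-from-bot i x = bundle-reach m (λ b → i , x , bundle b) v₁ v₂
    (λ j e → cong-local i x (α₁-local-digon (kind i x) j e)) (λ _ → refl)

  reach-bundle : ∀ i x b →
    Reach vertexGens (i , x , bundle (chain-end (kind i x))) (i , x , bundle b)
  reach-bundle i true b =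
    reach-sym vertexGens-involutive (reach-from-bot i true top) ◅◅ reach-from-bot i true b
  reach-bundle zero false = reach-from-bot zero false
  reach-bundle (suc i) false = reach-from-bot (suc i) false

  reach-loop-outer : ∀ i x t → Reach vertexGens (i , x , link false) (i , x , loop t false false)
  reach-loop-outer i true t = reach-loop i true t ▷ v₂ ▷ v₁
  reach-loop-outer (suc i) false t = reach-loop (suc i) false t ▷ v₂ ▷ v₁
  reach-loop-outer zero false zero = ε ▷ v₂ ▷ v₁
  reach-loop-outer zero false (suc t) = reach-loop zero false (suc t) ▷ v₂ ▷ v₁

  reach-vertex : ∀ i x l → Reach vertexGens (i , x , link false) (i , x , l)
  reach-vertex i x (link false) = ε
  reach-vertex i x (link true) = ε ▷ v₂
  reach-vertex i x (loop t true false) = reach-loop i x t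
  reach-vertex i x (loop t true true) = reach-loop i x t ▷ v₂
  reach-vertex i x (loop t false false) = reach-loop-outer i x t
  reach-vertex i x (loop t false true) = reach-loop-outer i x t ▷ v₂
  reach-vertex i x (bundle b) =
    reach-loop i x (fromℕ h′)
      ▷⟨ v₁ ⟩ cong-local i x (trans (α₁-local-loop-end (kind i x) (fromℕ h′)) (after-loop-last _))
      ◅◅ reach-bundle i x b

  vertexDegrees : List ℕ
  vertexDegrees = replicate (2 * k) (a + m)

  vertex↔Fin : (Fin k × Bool) ↔ Fin (length vertexDegrees)
  vertex↔Fin = resize (↔-refl ×-↔Fin Bool↔Fin2) (trans (*-comm k 2) (sym (length-replicate (2 * k))))

  vertexCells : CellDecomposition vertexGens vertexDegrees
  vertexCells = record
    { cell = λ (i , x , _) → to (i , x)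
    ; cell-invariant = λ { (here refl) _ → refl ; (there (here refl)) _ → refl }
    ; centre = λ ℓ → proj₁ (from ℓ) , proj₂ (from ℓ) , link false
    ; reach-from-centre = λ (i , x , l) →
        subst (λ (j , y) → Reach vertexGens (j , y , link false) (i , x , l))
              (sym (strictlyInverseʳ (i , x))) (reach-vertex i x l)
    ; cell-size = λ ℓ → record
      { Index = Local
      ; Index↔Fin = resize local↔Fin
          (trans (index-count h m) (cong (2 *_) (sym (lookup-replicate′ (2 * k) (a + m) ℓ))))
      ; elem = λ l → proj₁ (from ℓ) , proj₂ (from ℓ) , l
      ; index = λ (_ , _ , l) → l
      ; lab-elem = λ _ → strictlyInverseˡ ℓ
      ; index-elem = λ _ → refl
      ; elem-index = λ (i , x , l) eq →
          cong (λ (j , y) → j , y , l) (trans (cong from (sym eq)) (strictlyInverseʳ (i , x)))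
      }
    }
    where
    open Inverse vertex↔Fin using (to; from; strictlyInverseˡ; strictlyInverseʳ)
    index-count : ∀ h m → 2 + (h * (2 * 2) + (2 + m * 2)) ≡ 2 * (suc h * 2 + m)
    index-count = solve-∀

  countryDegrees : List ℕ
  countryDegrees = (a * k + 1) ∷ (a * k ∸ 1) ∷ replicate (k * m) 2

  Country : Set
  Country = Fin (length countryDegrees)

  large₁ large₂ : Country
  large₁ = zero
  large₂ = suc zero

  digon↔Fin : (Fin k × Fin m) ↔ Fin (length (replicate (k * m) 2))
  digon↔Fin = resize (↔-sym *↔×) (sym (length-replicate (k * m)))

  digon-country : Fin k → Fin m → Country
  digon-country i j = suc (suc (Inverse.to digon↔Fin (i , j)))

  bundle-country : Fin k → BundleFlag m → Country
  bundle-country i top = large₁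
  bundle-country i bot = large₂
  bundle-country i (digon j e) = digon-country i j

  country : Flag → Country
  country (i , x , bundle b) = bundle-country i b
  country (i , true , link false) = large₁
  country (i , true , link true) = large₂
  country (i , true , loop _ _ _) = large₁
  country (zero , false , link false) = large₁
  country (zero , false , link true) = large₂
  country (zero , false , loop _ _ false) = large₂
  country (zero , false , loop zero _ true) = large₁
  country (zero , false , loop (suc _) _ true) = large₂
  country (suc _ , false , link false) = large₂
  country (suc _ , false , link true) = large₁
  country (suc _ , false , loop _ _ _) = large₂

  country-u₀-after-loop : ∀ t → country (zero , false , after-loop bot t) ≡ large₂
  country-u₀-after-loop t with view t
  ... | ‵fromℕ = refl
  ... | ‵inject₁ j = refl

  country-α₁ : ∀ y → country (α₁ y) ≡ country y
  country-α₁ (i , true , link false) = refl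
  country-α₁ (i , true , link true) = refl
  country-α₁ (i , true , loop t false false) = refl
  country-α₁ (i , true , loop t true true) = refl
  country-α₁ (i , true , loop t true false) with view t
  ... | ‵fromℕ = refl
  ... | ‵inject₁ j = refl
  country-α₁ (i , true , loop zero false true) = refl
  country-α₁ (i , true , loop (suc j) false true) = refl
  country-α₁ (i , true , bundle top) = refl
  country-α₁ (i , true , bundle bot) = refl
  country-α₁ (i , true , bundle (digon j e)) = refl
  country-α₁ (suc i , false , link false) = refl
  country-α₁ (suc i , false , link true) = refl
  country-α₁ (suc i , false , loop t false false) = refl
  country-α₁ (suc i , false , loop t true true) = refl
  country-α₁ (suc i , false , loop t true false) with view t
  ... | ‵fromℕ = refl
  ... | ‵inject₁ j = refl
  country-α₁ (suc i , false , loop zero false true) = refl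
  country-α₁ (suc i , false , loop (suc j) false true) = refl
  country-α₁ (suc i , false , bundle top) = refl
  country-α₁ (suc i , false , bundle bot) = refl
  country-α₁ (suc i , false , bundle (digon j e)) = refl
  country-α₁ (zero , false , link false) = refl
  country-α₁ (zero , false , link true) = refl
  country-α₁ (zero , false , loop zero false false) = refl
  country-α₁ (zero , false , loop zero false true) = refl
  country-α₁ (zero , false , loop zero true true) = refl
  country-α₁ (zero , false , loop t true false) = country-u₀-after-loop t
  country-α₁ (zero , false , loop (suc j) false false) = refl
  country-α₁ (zero , false , loop (suc j) true true) = refl
  country-α₁ (zero , false , loop (suc j) false true) = refl
  country-α₁ (zero , false , bundle top) = refl
  country-α₁ (zero , false , bundle bot) = refl
  country-α₁ (zero , false , bundle (digon j e)) = refl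

  country-α₀ : ∀ y → country (α₀ y) ≡ country y
  country-α₀ (i , x , bundle b) = refl
  country-α₀ (i , true , loop t f s) = refl
  country-α₀ (zero , false , loop t f false) = refl
  country-α₀ (zero , false , loop zero f true) = refl
  country-α₀ (zero , false , loop (suc t) f true) = refl
  country-α₀ (suc i , false , loop t f s) = refl
  country-α₀ (zero , false , link false) = refl
  country-α₀ (zero , false , link true) = refl
  country-α₀ (suc j , false , link false) = refl
  country-α₀ (suc j , false , link true) = refl
  country-α₀ (i , true , link false) with view i
  ... | ‵fromℕ = refl
  ... | ‵inject₁ j = refl
  country-α₀ (i , true , link true) with view i
  ... | ‵fromℕ = refl
  ... | ‵inject₁ j = refl

  faceGens : List (Flag → Flag)
  faceGens = α₀ ∷ α₁ ∷ []

  f₀ : α₀ ∈ faceGens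
  f₀ = here refl

  f₁ : α₁ ∈ faceGens
  f₁ = there (here refl)

  faceGens-involutive : Involutive faceGens
  faceGens-involutive (here refl) = α₀-involutive
  faceGens-involutive (there (here refl)) = α₁-involutive

  country-invariant : ∀ {f} → f ∈ faceGens → ∀ y → country (f y) ≡ country y
  country-invariant (here refl) = country-α₀
  country-invariant (there (here refl)) = country-α₁

  α₁-local-u-bot : ∀ i → α₁-local (kind i false) (bundle bot) ≡ loop (fromℕ h′) true false
  α₁-local-u-bot zero = refl
  α₁-local-u-bot (suc i) = refl

  α₁-local-u-loop : ∀ i j →
    α₁-local (kind i false) (loop (suc j) false true) ≡ loop (inject₁ j) true false
  α₁-local-u-loop zero j = refl
  α₁-local-u-loop (suc i) j = refl

  centre₁ centre₂ : Fin k → Flag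
  centre₁ i = i , true , link false
  centre₂ i = i , true , link true

  reach₁-w-loop : ∀ i t → Reach faceGens (centre₁ i) (i , true , loop t false true)
  reach₁-w-loop i = <-weakInduction _ (ε ▷ f₁) λ j p →
    p ▷ f₀ ▷ f₁ ▷ f₀ ▷⟨ f₁ ⟩ cong-local i true (after-loop-inject₁ top j)

  reach₁-w-top : ∀ i → Reach faceGens (centre₁ i) (i , true , bundle top)
  reach₁-w-top i =
    reach₁-w-loop i (fromℕ h′) ▷ f₀ ▷ f₁ ▷ f₀ ▷⟨ f₁ ⟩ cong-local i true (after-loop-last top)

  reach₁-u-link : ∀ j → Reach faceGens (centre₁ (suc j)) (suc j , false , link true)
  reach₁-u-link j = reach₁-w-top (suc j) ▷ f₀ ▷ f₁

  reach₁ : ∀ i → Reach faceGens (centre₁ zero) (centre₁ i)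
  reach₁ = <-weakInduction _ ε λ j p →
    p ▷⟨ f₀ ⟩ α₀-link-w-inject₁ j false ◅◅ reach-sym faceGens-involutive (reach₁-u-link j)

  reach₂-u-loop : ∀ i t → Reach faceGens (centre₂ i) (i , false , loop t true false)
  reach₂-u-loop i = >-weakInduction _
    (ε ▷ f₁ ▷ f₀ ▷⟨ f₁ ⟩ cong-local i false (α₁-local-u-bot i)) λ j p →
    p ▷ f₀ ▷⟨ f₁ ⟩ cong-local i false (α₁-local-loop-false-false (kind i false) j)
      ▷ f₀ ▷⟨ f₁ ⟩ cong-local i false (α₁-local-u-loop i j)

  reach₂-u-link : ∀ j → Reach faceGens (centre₂ (suc j)) (suc j , false , link false)
  reach₂-u-link j = reach₂-u-loop (suc j) zero ▷ f₀ ▷ f₁ ▷ f₀ ▷ f₁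

  reach₂ : ∀ i → Reach faceGens (centre₂ zero) (centre₂ i)
  reach₂ = <-weakInduction _ ε λ j p →
    p ▷⟨ f₀ ⟩ α₀-link-w-inject₁ j true ◅◅ reach-sym faceGens-involutive (reach₂-u-link j)

  digon-centre : Fin k × Fin m → Flag
  digon-centre (i , j) = i , false , bundle (digon j false)

  reach-digon : ∀ i j x e → Reach faceGens (digon-centre (i , j)) (i , x , bundle (digon j e))
  reach-digon i j false false = ε
  reach-digon i j false true = ε ▷⟨ f₁ ⟩ cong-local i false (α₁-local-digon (kind i false) j false)
  reach-digon i j true false = ε ▷ f₀
  reach-digon i j true true = ε ▷ f₀ ▷ f₁

  centre : Country → Flag
  centre zero = centre₁ zero
  centre (suc zero) = centre₂ zero
  centre (suc (suc r)) = digon-centre (Inverse.from digon↔Fin r)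

  reach-country : ∀ y → Reach faceGens (centre (country y)) y
  reach-country (i , true , bundle top) = reach₁ i ◅◅ reach₁-w-top i
  reach-country (i , false , bundle top) = reach₁ i ◅◅ reach₁-w-top i ▷ f₀
  reach-country (i , true , bundle bot) = reach₂ i ▷ f₁
  reach-country (i , false , bundle bot) = reach₂ i ▷ f₁ ▷ f₀
  reach-country (i , x , bundle (digon j e)) =
    subst (λ c → Reach faceGens (digon-centre c) (i , x , bundle (digon j e)))
          (sym (Inverse.strictlyInverseʳ digon↔Fin (i , j))) (reach-digon i j x e)
  reach-country (i , true , link false) = reach₁ i
  reach-country (i , true , link true) = reach₂ i
  reach-country (i , true , loop t false true) = reach₁ i ◅◅ reach₁-w-loop i t
  reach-country (i , true , loop t true true) = reach₁ i ◅◅ reach₁-w-loop i t ▷ f₀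
  reach-country (i , true , loop t false false) = reach₁ i ◅◅ reach₁-w-loop i t ▷ f₀ ▷ f₁
  reach-country (i , true , loop t true false) = reach₁ i ◅◅ reach₁-w-loop i t ▷ f₀ ▷ f₁ ▷ f₀
  reach-country (zero , false , link false) = reach₁-w-top zero ▷ f₀ ▷ f₁ ▷ f₀ ▷ f₁
  reach-country (zero , false , link true) = reach₂-u-loop zero zero ▷ f₀ ▷ f₁
  reach-country (zero , false , loop zero false true) = reach₁-w-top zero ▷ f₀ ▷ f₁
  reach-country (zero , false , loop zero true true) = reach₁-w-top zero ▷ f₀ ▷ f₁ ▷ f₀
  reach-country (zero , false , loop t true false) = reach₂-u-loop zero t
  reach-country (zero , false , loop t false false) = reach₂-u-loop zero t ▷ f₀
  reach-country (zero , false , loop (suc t) true true) = reach₂-u-loop zero (suc t) ▷ f₀ ▷ f₁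
  reach-country (zero , false , loop (suc t) false true) = reach₂-u-loop zero (suc t) ▷ f₀ ▷ f₁ ▷ f₀
  reach-country (suc j , false , link false) = reach₂ (suc j) ◅◅ reach₂-u-link j
  reach-country (suc j , false , link true) = reach₁ (suc j) ◅◅ reach₁-u-link j
  reach-country (suc j , false , loop t true false) = reach₂ (suc j) ◅◅ reach₂-u-loop (suc j) t
  reach-country (suc j , false , loop t false false) = reach₂ (suc j) ◅◅ reach₂-u-loop (suc j) t ▷ f₀
  reach-country (suc j , false , loop t true true) = reach₂ (suc j) ◅◅ reach₂-u-loop (suc j) t ▷ f₀ ▷ f₁
  reach-country (suc j , false , loop t false true) =
    reach₂ (suc j) ◅◅ reach₂-u-loop (suc j) t ▷ f₀ ▷ f₁ ▷ f₀

  large₁-fibre : FibreEnumeration country large₁ (2 * (a * k + 1))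
  large₁-fibre = record
    { Index = Index
    ; Index↔Fin = resize (Bool↔Fin2 ⊎-↔Fin ↔-refl ×-↔Fin
                           ((↔-refl ×-↔Fin Bool↔Fin2 ×-↔Fin Bool↔Fin2)
                            ⊎-↔Fin (Bool↔Fin2 ×-↔Fin Bool↔Fin2)))
                         (index-count k h)
    ; elem = elem ; index = index
    ; lab-elem = lab-elem ; index-elem = index-elem ; elem-index = elem-index
    }
    where
    index-count : ∀ k h → 2 + k * (h * (2 * 2) + 2 * 2) ≡ 2 * (suc h * 2 * k + 1)
    index-count = solve-∀
    Index = Bool ⊎ (Fin k × ((Fin h × Bool × Bool) ⊎ (Bool × Bool)))
    elem : Index → Flag
    elem (inj₁ f) = zero , false , loop zero f true
    elem (inj₂ (i , inj₁ (t , f , s))) = i , true , loop t f s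
    elem (inj₂ (i , inj₂ (false , false))) = i , true , link false
    elem (inj₂ (i , inj₂ (false , true))) = i , true , bundle top
    elem (inj₂ (i , inj₂ (true , false))) = i , false , bundle top
    elem (inj₂ (zero , inj₂ (true , true))) = zero , false , link false
    elem (inj₂ (suc j , inj₂ (true , true))) = suc j , false , link true
    index : Flag → Index
    index (i , x , bundle top) = inj₂ (i , inj₂ (not x , x))
    index (i , true , link false) = inj₂ (i , inj₂ (false , false))
    index (i , true , loop t f s) = inj₂ (i , inj₁ (t , f , s))
    index (zero , false , link false) = inj₂ (zero , inj₂ (true , true))
    index (zero , false , loop zero f true) = inj₁ f
    index (suc j , false , link true) = inj₂ (suc j , inj₂ (true , true))
    index _ = inj₁ false
    lab-elem : ∀ t → country (elem t) ≡ large₁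
    lab-elem (inj₁ f) = refl
    lab-elem (inj₂ (i , inj₁ _)) = refl
    lab-elem (inj₂ (i , inj₂ (false , false))) = refl
    lab-elem (inj₂ (i , inj₂ (false , true))) = refl
    lab-elem (inj₂ (i , inj₂ (true , false))) = refl
    lab-elem (inj₂ (zero , inj₂ (true , true))) = refl
    lab-elem (inj₂ (suc j , inj₂ (true , true))) = refl
    index-elem : ∀ t → index (elem t) ≡ t
    index-elem (inj₁ f) = refl
    index-elem (inj₂ (i , inj₁ _)) = refl
    index-elem (inj₂ (i , inj₂ (false , false))) = refl
    index-elem (inj₂ (i , inj₂ (false , true))) = refl
    index-elem (inj₂ (i , inj₂ (true , false))) = refl
    index-elem (inj₂ (zero , inj₂ (true , true))) = refl
    index-elem (inj₂ (suc j , inj₂ (true , true))) = refl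
    elem-index : ∀ y → country y ≡ large₁ → elem (index y) ≡ y
    elem-index (i , false , bundle top) _ = refl
    elem-index (i , true , bundle top) _ = refl
    elem-index (i , x , bundle bot) ()
    elem-index (i , true , link false) _ = refl
    elem-index (i , true , link true) ()
    elem-index (i , true , loop t f s) _ = refl
    elem-index (zero , false , link false) _ = refl
    elem-index (zero , false , link true) ()
    elem-index (zero , false , loop _ _ false) ()
    elem-index (zero , false , loop zero f true) _ = refl
    elem-index (zero , false , loop (suc _) _ true) ()
    elem-index (suc j , false , link false) ()
    elem-index (suc j , false , link true) _ = refl
    elem-index (suc j , false , loop _ _ _) ()

  -- a * k is a successor, so a * k ∸ 1 computes and index-count needs no truncated subtraction.
  large₂-fibre : FibreEnumeration country large₂ (2 * (a * k ∸ 1))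
  large₂-fibre = record
    { Index = Index
    ; Index↔Fin = resize ((↔-refl ×-↔Fin Bool↔Fin2 ×-↔Fin Bool↔Fin2)
                          ⊎-↔Fin (↔-refl ×-↔Fin ↔-refl ×-↔Fin Bool↔Fin2 ×-↔Fin Bool↔Fin2)
                          ⊎-↔Fin (↔-refl ×-↔Fin Bool↔Fin2 ×-↔Fin Bool↔Fin2)
                          ⊎-↔Fin Bool↔Fin2)
                         (index-count k′ h′)
    ; elem = elem ; index = index
    ; lab-elem = lab-elem ; index-elem = index-elem ; elem-index = elem-index
    }
    where
    index-count : ∀ k′ h′ → suc k′ * (2 * 2) + (k′ * (suc h′ * (2 * 2)) + (h′ * (2 * 2) + 2))
                      ≡ 2 * (k′ + suc (suc h′ * 2) * suc k′)
    index-count = solve-∀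
    Index = (Fin k × Bool × Bool) ⊎ (Fin k′ × Fin h × Bool × Bool) ⊎ (Fin h′ × Bool × Bool) ⊎ Bool
    elem : Index → Flag
    elem (inj₁ (i , false , false)) = i , true , link true
    elem (inj₁ (i , false , true)) = i , true , bundle bot
    elem (inj₁ (i , true , false)) = i , false , bundle bot
    elem (inj₁ (zero , true , true)) = zero , false , link true
    elem (inj₁ (suc j , true , true)) = suc j , false , link false
    elem (inj₂ (inj₁ (j , t , f , s))) = suc j , false , loop t f s
    elem (inj₂ (inj₂ (inj₁ (t , f , s)))) = zero , false , loop (suc t) f s
    elem (inj₂ (inj₂ (inj₂ f))) = zero , false , loop zero f false
    index : Flag → Index
    index (i , x , bundle bot) = inj₁ (i , not x , x)
    index (i , true , link true) = inj₁ (i , false , false)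
    index (zero , false , link true) = inj₁ (zero , true , true)
    index (zero , false , loop zero f false) = inj₂ (inj₂ (inj₂ f))
    index (zero , false , loop (suc t) f s) = inj₂ (inj₂ (inj₁ (t , f , s)))
    index (suc j , false , link false) = inj₁ (suc j , true , true)
    index (suc j , false , loop t f s) = inj₂ (inj₁ (j , t , f , s))
    index _ = inj₂ (inj₂ (inj₂ false))
    lab-elem : ∀ t → country (elem t) ≡ large₂
    lab-elem (inj₁ (i , false , false)) = refl
    lab-elem (inj₁ (i , false , true)) = refl
    lab-elem (inj₁ (i , true , false)) = refl
    lab-elem (inj₁ (zero , true , true)) = refl
    lab-elem (inj₁ (suc j , true , true)) = refl
    lab-elem (inj₂ (inj₁ _)) = refl
    lab-elem (inj₂ (inj₂ (inj₁ (_ , _ , false)))) = refl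
    lab-elem (inj₂ (inj₂ (inj₁ (_ , _ , true)))) = refl
    lab-elem (inj₂ (inj₂ (inj₂ f))) = refl
    index-elem : ∀ t → index (elem t) ≡ t
    index-elem (inj₁ (i , false , false)) = refl
    index-elem (inj₁ (i , false , true)) = refl
    index-elem (inj₁ (i , true , false)) = refl
    index-elem (inj₁ (zero , true , true)) = refl
    index-elem (inj₁ (suc j , true , true)) = refl
    index-elem (inj₂ (inj₁ _)) = refl
    index-elem (inj₂ (inj₂ (inj₁ _))) = refl
    index-elem (inj₂ (inj₂ (inj₂ f))) = refl
    elem-index : ∀ y → country y ≡ large₂ → elem (index y) ≡ y
    elem-index (i , x , bundle top) ()
    elem-index (i , false , bundle bot) _ = refl
    elem-index (i , true , bundle bot) _ = refl
    elem-index (i , true , link false) ()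
    elem-index (i , true , link true) _ = refl
    elem-index (i , true , loop _ _ _) ()
    elem-index (zero , false , link false) ()
    elem-index (zero , false , link true) _ = refl
    elem-index (zero , false , loop zero f true) ()
    elem-index (zero , false , loop zero f false) _ = refl
    elem-index (zero , false , loop (suc t) f false) _ = refl
    elem-index (zero , false , loop (suc t) f true) _ = refl
    elem-index (suc j , false , link false) _ = refl
    elem-index (suc j , false , link true) ()
    elem-index (suc j , false , loop t f s) _ = refl

  digon-fibre : ∀ r → FibreEnumeration country (suc (suc r)) (2 * lookup (replicate (k * m) 2) r)
  digon-fibre r = record
    { Index = Bool × Bool
    ; Index↔Fin = resize (Bool↔Fin2 ×-↔Fin Bool↔Fin2)
                         (cong (2 *_) (sym (lookup-replicate′ (k * m) 2 r)))
    ; elem = elem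
    ; index = index
    ; lab-elem = λ _ → cong (λ c → suc (suc c)) (Inverse.strictlyInverseˡ digon↔Fin r)
    ; index-elem = λ _ → refl
    ; elem-index = elem-index
    }
    where
    i = proj₁ (Inverse.from digon↔Fin r)
    j = proj₂ (Inverse.from digon↔Fin r)
    elem : Bool × Bool → Flag
    elem (x , e) = i , x , bundle (digon j e)
    index : Flag → Bool × Bool
    index (_ , x , bundle (digon _ e)) = x , e
    index _ = false , false
    elem-index : ∀ y → country y ≡ suc (suc r) → elem (index y) ≡ y
    elem-index (i′ , x , bundle (digon j′ e)) eq =
      cong (λ (i , j) → i , x , bundle (digon j e))
           (trans (cong (Inverse.from digon↔Fin) (sym (suc-injective (suc-injective eq))))
                  (Inverse.strictlyInverseʳ digon↔Fin (i′ , j′)))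
    elem-index (_ , _ , bundle top) ()
    elem-index (_ , _ , bundle bot) ()
    elem-index (_ , true , link false) ()
    elem-index (_ , true , link true) ()
    elem-index (_ , true , loop _ _ _) ()
    elem-index (zero , false , link false) ()
    elem-index (zero , false , link true) ()
    elem-index (zero , false , loop _ _ false) ()
    elem-index (zero , false , loop zero _ true) ()
    elem-index (zero , false , loop (suc _) _ true) ()
    elem-index (suc _ , false , link false) ()
    elem-index (suc _ , false , link true) ()
    elem-index (suc _ , false , loop _ _ _) ()

  countryCells : CellDecomposition faceGens countryDegrees
  countryCells = record
    { cell = country
    ; cell-invariant = country-invariant
    ; centre = centre
    ; reach-from-centre = reach-country
    ; cell-size = λ where
        zero → large₁-fibre
        (suc zero) → large₂-fibre
        (suc (suc r)) → digon-fibre r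
    }

  allGens : List (Flag → Flag)
  allGens = α₀ ∷ α₁ ∷ α₂ ∷ []

  allGens-involutive : Involutive allGens
  allGens-involutive (here refl) = α₀-involutive
  allGens-involutive (there (here refl)) = α₁-involutive
  allGens-involutive (there (there (here refl))) = α₂-involutive

  faceGens⊆allGens : faceGens ⊆ allGens
  faceGens⊆allGens (here refl) = here refl
  faceGens⊆allGens (there (here refl)) = there (here refl)

  vertexGens⊆allGens : vertexGens ⊆ allGens
  vertexGens⊆allGens (here refl) = there (here refl)
  vertexGens⊆allGens (there (here refl)) = there (there (here refl))

  reach-all : ∀ y → Reach allGens (centre₁ zero) y
  reach-all (i , true , l) =
    reach-mono faceGens⊆allGens (reach₁ i) ◅◅ reach-mono vertexGens⊆allGens (reach-vertex i true l)
  reach-all (i , false , l) =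
    reach-mono faceGens⊆allGens (reach₁ i ◅◅ reach₁-w-top i ▷ f₀)
      ◅◅ reach-mono vertexGens⊆allGens
           (reach-sym vertexGens-involutive (reach-vertex i false (bundle top)) ◅◅ reach-vertex i false l)

  open FlagMap system

  realizable : Realizable vertexDegrees countryDegrees
  realizable =
    cmap ,
    connected (λ x y → reach-sym allGens-involutive (reach-all x) ◅◅ reach-all y) ,
    cellDegrees vertexGens-involutive vertexCells ,
    cellDegrees faceGens-involutive countryCells

proposition5p3 : (n k a : ℕ) → 1 ≤ k → 4 ≤ a → a ≤ n → 2 ∣ a →
    Realizable (replicate (2 * k) n)
               ((a * k + 1) ∷ (a * k ∸ 1) ∷ replicate (k * (n ∸ a)) 2)
proposition5p3 n (suc k′) a (s≤s z≤n) _ a≤n (divides (suc (suc h′)) refl) =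
  subst (λ d → Realizable (replicate (2 * k) d) countryDegrees) (m+[n∸m]≡n a≤n) realizable
  where open Construction k′ h′ (n ∸ a)
proposition5p3 _ _ _ _ (s≤s (s≤s ())) _ (divides (suc zero) refl)
proposition5p3 _ _ _ _ () _ (divides zero refl)
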